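{- Let $a,b$ be positive integers with $a\neq b$. Then $t(a,b)=a+b$.
   Context: An $r$-graph is a hypergraph all of whose edges have exactly $r$ vertices. A hypergraph is intersecting if every two of its edges have nonempty intersection. For a hypergraph $H$, $\tau(H)$ is the minimum size of a cover, i.e. of a vertex set meeting every edge. Given a vector $\vec{a}=(a_1,\ldots,a_p)$ of positive integers with $\sum_{i\le p}a_i=r$, an $r$-graph $H$ is $\vec{a}$-partitioned if $V(H)=\bigcup_{i\le p}V_i$ with the $V_i$ pairwise disjoint and $|e\cap V_i|=a_i$ for every edge $e\in H$ and every $i\le p$. $t(\vec{a})$ (written $t(a_1,\ldots,a_p)$) denotes the maximum of $\tau(H)$ over all (finite) intersecting $\vec{a}$-partitioned $r$-graphs $H$. -}

module Defs where

open import Data.Nat using (ℕ; _≤_)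
open import Data.Fin using (Fin; _≟_)
open import Data.Fin.Subset using (Subset; _∩_; ∣_∣; Nonempty)
open import Data.Vec using (Vec; lookup; tabulate)
open import Data.List using (List)
open import Data.List.Membership.Propositional using (_∈_)
open import Data.Product using (Σ; _×_; ∃)
open import Relation.Nullary using (does)
open import Relation.Binary.PropositionalEquality using (_≡_)

Hypergraph : ℕ → Set
Hypergraph n = List (Subset n)

Intersecting : ∀ {n} → Hypergraph n → Set
Intersecting H = ∀ {e f} → e ∈ H → f ∈ H → Nonempty (e ∩ f)

IsCover : ∀ {n} → Hypergraph n → Subset n → Set
IsCover H C = ∀ {e} → e ∈ H → Nonempty (e ∩ C)

IsCoverNumber : ∀ {n} → Hypergraph n → ℕ → Set
IsCoverNumber {n} H k =
  (Σ (Subset n) λ C → IsCover H C × ∣ C ∣ ≡ k) ×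
  (∀ (C : Subset n) → IsCover H C → k ≤ ∣ C ∣)

Part : ∀ {n p} → (Fin n → Fin p) → Fin p → Subset n
Part part i = tabulate (λ v → does (part v ≟ i))

Partitioned : ∀ {p n} → Vec ℕ p → Hypergraph n → Set
Partitioned {p} {n} a H =
  Σ (Fin n → Fin p) λ part → ∀ {e} → e ∈ H → ∀ (i : Fin p) → ∣ e ∩ Part part i ∣ ≡ lookup a i

-- t(a⃗) ≡ m : m is the maximum of τ(H) over all finite intersecting a⃗-partitioned H
IsT : ∀ {p} → Vec ℕ p → ℕ → Set
IsT a m =
  (∀ (n : ℕ) (H : Hypergraph n) (k : ℕ) →
     Intersecting H → Partitioned a H → IsCoverNumber H k → k ≤ m) ×
  (Σ ℕ λ n → Σ (Hypergraph n) λ H →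
     Intersecting H × Partitioned a H × IsCoverNumber H m)

module Submission where

-- Upper bound: every edge of an intersecting hypergraph is a cover, and an edge of
-- an (a,b)-partitioned hypergraph has a + b vertices.
--
-- Lower bound: we build a "realisation" of (a,b): an intersecting hypergraph whose
-- vertices are 2-coloured so that every edge has a vertices of the first colour and
-- b of the second, and whose covers all have at least a + b vertices.  Realisations
-- are grown by an extension lemma: a realisation of (a,b) together with a "gadget"
-- (guards of profile (p,q), pairwise intersecting tails of profile (p+a,q+b)) yields
-- a realisation of (p+a,q+b); its edges are guard ++ edge and tail ++ ∅.  Starting
-- from the single vertex, the singleton gadget climbs from (0,b) to (0,1+b), and the
-- doubling gadget climbs from (a,b) to (1+a,1+b) whenever a < b — this is where
-- a ≢ b is used: two tails overlap only because 2(1+a) < (1+a) + (1+b).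
-- Swapping the colours covers the case b < a.

open import Defs
open import Data.Nat using (ℕ; _+_; _≤_)
open import Data.Vec using (_∷_; [])
open import Relation.Binary.PropositionalEquality using (_≢_)

open import Data.Nat using (zero; suc; _∸_; _<_; z≤n; s≤s)
open import Data.Nat.Properties
  using (module ≤-Reasoning; ≤-trans; ≤-reflexive; m≤m+n; +-mono-≤; +-monoʳ-≤; +-suc; +-identityʳ; +-comm; <⇒≱;
         m+n∸m≡n; m∸n+n≡m; +-monoʳ-<; <⇒≤; <-cmp; +-commutativeSemigroup)
open import Algebra.Properties.CommutativeSemigroup +-commutativeSemigroup using (interchange)
open import Data.Bool using (Bool; true; false; not; _∧_)
open import Data.Bool.Properties using (not-involutive)
open import Data.Fin using (Fin; zero; suc; _↑ˡ_; _↑ʳ_; _≟_)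
open import Data.Fin.Subset
  using (Subset; _∩_; _∪_; ∁; ∣_∣; Nonempty; ⊥; ⊤; ⁅_⁆; _-_)
  renaming (_∈_ to _∈ₛ_; _∉_ to _∉ₛ_)
open import Data.Fin.Subset.Properties
  using (_∈?_; nonempty?; ∉⊥; ∈⊤; x∈⁅x⁆; x∈⁅y⁆⇒x≡y; ∣⁅x⁆∣≡1; ∣⊥∣≡0; ∣⊤∣≡n; ∣p∣≤∣x∷p∣;
         ∣∁p∣≡n∸∣p∣; p⊆q⇒∣p∣≤∣q∣; x∈p∩q⁺; x∈p∩q⁻; x∈p∪q⁺; x∉p⇒x∈∁p; x∈p⇒x∉∁p;
         ∩-comm; ∩-identityʳ; ∩-zeroˡ; ∩-zeroʳ; x∈p∧x≢y⇒x∈p-y; x∈p⇒∣p-x∣<∣p∣)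
open import Data.Vec using (_++_; lookup; here; there; splitAt)
open import Data.Vec.Properties using (zipWith-++; map-++; map-replicate; map-∘; map-cong; map-id; tabulate-cong; tabulate-∘; tabulate∘lookup)
open import Data.List using (List; map; allFin; cartesianProductWith) renaming ([] to []ₗ; _∷_ to _∷ₗ_; _++_ to _++ₗ_)
open import Data.List.Membership.Propositional using (_∈_; find)
open import Data.List.Membership.Propositional.Properties
  using (∈-map⁺; ∈-map⁻; ∈-++⁺ˡ; ∈-++⁺ʳ; ∈-++⁻; ∈-allFin; ∈-cartesianProductWith⁺; ∈-cartesianProductWith⁻)
open import Data.List.Relation.Unary.Any using (here; there)
import Data.List.Relation.Unary.All as All
open import Data.List.Relation.Unary.All.Properties using (¬All⇒Any¬)
open import Data.Product using (Σ; _×_; _,_; proj₁; proj₂; ∃)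
open import Data.Sum using (_⊎_; inj₁; inj₂)
open import Data.Empty using (⊥-elim)
open import Relation.Nullary using (¬_; yes; no; does; contradiction)
open import Relation.Binary using (tri<; tri≈; tri>)
open import Relation.Binary.PropositionalEquality using (_≡_; refl; sym; trans; cong; cong₂; subst; subst₂)

∩-++ : ∀ {m n} (p p' : Subset m) (q q' : Subset n) → (p ++ q) ∩ (p' ++ q') ≡ (p ∩ p') ++ (q ∩ q')
∩-++ p p' q q' = zipWith-++ _∧_ p q p' q'

∁-++ : ∀ {m n} (p : Subset m) (q : Subset n) → ∁ (p ++ q) ≡ ∁ p ++ ∁ q
∁-++ = map-++ not

∣++∣ : ∀ {m n} (p : Subset m) (q : Subset n) → ∣ p ++ q ∣ ≡ ∣ p ∣ + ∣ q ∣
∣++∣ [] q = refl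
∣++∣ (true ∷ p) q = cong suc (∣++∣ p q)
∣++∣ (false ∷ p) q = ∣++∣ p q

∣∩++∣ : ∀ {m n} (p p' : Subset m) (q q' : Subset n) → ∣ (p ++ q) ∩ (p' ++ q') ∣ ≡ ∣ p ∩ p' ∣ + ∣ q ∩ q' ∣
∣∩++∣ p p' q q' = trans (cong ∣_∣ (∩-++ p p' q q')) (∣++∣ (p ∩ p') (q ∩ q'))

∈-↑ˡ⁺ : ∀ {m n} {x : Fin m} (p : Subset m) (q : Subset n) → x ∈ₛ p → (x ↑ˡ n) ∈ₛ (p ++ q)
∈-↑ˡ⁺ (true ∷ p) q here = here
∈-↑ˡ⁺ (_ ∷ p) q (there x∈) = there (∈-↑ˡ⁺ p q x∈)

∈-↑ʳ⁺ : ∀ {m n} {y : Fin n} (p : Subset m) (q : Subset n) → y ∈ₛ q → (m ↑ʳ y) ∈ₛ (p ++ q)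
∈-↑ʳ⁺ [] q y∈ = y∈
∈-↑ʳ⁺ (_ ∷ p) q y∈ = there (∈-↑ʳ⁺ p q y∈)

∈-↑ˡ⁻ : ∀ {m n} {x : Fin m} (p : Subset m) (q : Subset n) → (x ↑ˡ n) ∈ₛ (p ++ q) → x ∈ₛ p
∈-↑ˡ⁻ {x = zero} (true ∷ p) q here = here
∈-↑ˡ⁻ {x = suc x} (_ ∷ p) q (there x∈) = there (∈-↑ˡ⁻ p q x∈)

∈-↑ʳ⁻ : ∀ {m n} {y : Fin n} (p : Subset m) (q : Subset n) → (m ↑ʳ y) ∈ₛ (p ++ q) → y ∈ₛ q
∈-↑ʳ⁻ [] q y∈ = y∈
∈-↑ʳ⁻ (_ ∷ p) q (there y∈) = ∈-↑ʳ⁻ p q y∈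

data Block (m n : ℕ) : Fin (m + n) → Set where
  left  : (x : Fin m) → Block m n (x ↑ˡ n)
  right : (y : Fin n) → Block m n (m ↑ʳ y)

block : ∀ m n (v : Fin (m + n)) → Block m n v
block zero n v = right v
block (suc m) n zero = left zero
block (suc m) n (suc v) with block m n v
... | left x = left (suc x)
... | right y = right y

meets-++⁺ : ∀ {m n} (p p' : Subset m) (q q' : Subset n) →
            Nonempty (p ∩ p') ⊎ Nonempty (q ∩ q') → Nonempty ((p ++ q) ∩ (p' ++ q'))
meets-++⁺ {n = n} p p' q q' (inj₁ (x , x∈)) =
  x ↑ˡ n , subst (_ ∈ₛ_) (sym (∩-++ p p' q q')) (∈-↑ˡ⁺ (p ∩ p') (q ∩ q') x∈)
meets-++⁺ {m = m} p p' q q' (inj₂ (y , y∈)) =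
  m ↑ʳ y , subst (_ ∈ₛ_) (sym (∩-++ p p' q q')) (∈-↑ʳ⁺ (p ∩ p') (q ∩ q') y∈)

meets-++⁻ : ∀ {m n} (p p' : Subset m) (q q' : Subset n) →
            Nonempty ((p ++ q) ∩ (p' ++ q')) → Nonempty (p ∩ p') ⊎ Nonempty (q ∩ q')
meets-++⁻ {m} {n} p p' q q' (v , v∈) with block m n v
... | left x = inj₁ (x , ∈-↑ˡ⁻ (p ∩ p') (q ∩ q') (subst (_ ∈ₛ_) (∩-++ p p' q q') v∈))
... | right y = inj₂ (y , ∈-↑ʳ⁻ (p ∩ p') (q ∩ q') (subst (_ ∈ₛ_) (∩-++ p p' q q') v∈))

∁⊤≡⊥ : ∀ n → ∁ (⊤ {n}) ≡ ⊥
∁⊤≡⊥ n = map-replicate not true n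

∁⊥≡⊤ : ∀ n → ∁ (⊥ {n}) ≡ ⊤
∁⊥≡⊤ n = map-replicate not false n

∁-involutive : ∀ {n} (c : Subset n) → ∁ (∁ c) ≡ c
∁-involutive c = trans (sym (map-∘ not not c)) (trans (map-cong not-involutive c) (map-id c))

¬⊥-meets : ∀ {n} (p : Subset n) → ¬ Nonempty (⊥ ∩ p)
¬⊥-meets p (x , x∈) = ∉⊥ (proj₁ (x∈p∩q⁻ ⊥ p x∈))

meets-comm : ∀ {n} (p q : Subset n) → Nonempty (p ∩ q) → Nonempty (q ∩ p)
meets-comm p q = subst Nonempty (∩-comm p q)

⁅⁆-meets⁺ : ∀ {n} {i : Fin n} (p : Subset n) → i ∈ₛ p → Nonempty (⁅ i ⁆ ∩ p)
⁅⁆-meets⁺ {i = i} p i∈ = i , x∈p∩q⁺ (x∈⁅x⁆ i , i∈)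

⁅⁆-meets⁻ : ∀ {n} {i : Fin n} (p : Subset n) → Nonempty (⁅ i ⁆ ∩ p) → i ∈ₛ p
⁅⁆-meets⁻ {i = i} p (x , x∈) with x∈p∩q⁻ ⁅ i ⁆ p x∈
... | x∈⁅i⁆ , x∈p = subst (_∈ₛ p) (x∈⁅y⁆⇒x≡y i x∈⁅i⁆) x∈p

size-split : ∀ {n} (e c : Subset n) → ∣ e ∣ ≡ ∣ e ∩ c ∣ + ∣ e ∩ ∁ c ∣
size-split [] [] = refl
size-split (true ∷ e) (true ∷ c) = cong suc (size-split e c)
size-split (true ∷ e) (false ∷ c) = trans (cong suc (size-split e c)) (sym (+-suc _ _))
size-split (false ∷ e) (_ ∷ c) = size-split e c

one-point : ∀ {n} {x : Fin n} (p : Subset n) → x ∈ₛ p → 1 ≤ ∣ p ∣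
one-point {x = x} p x∈ =
  subst (_≤ ∣ p ∣) (∣⁅x⁆∣≡1 x) (p⊆q⇒∣p∣≤∣q∣ (λ y∈ → subst (_∈ₛ p) (sym (x∈⁅y⁆⇒x≡y x y∈)) x∈))

two-points : ∀ {n} {x y : Fin n} (p : Subset n) → x ∈ₛ p → y ∈ₛ p → x ≢ y → 2 ≤ ∣ p ∣
two-points {x = x} p x∈ y∈ x≢y =
  ≤-trans (s≤s (one-point (p - x) (x∈p∧x≢y⇒x∈p-y y∈ (λ y≡x → x≢y (sym y≡x))))) (x∈p⇒∣p-x∣<∣p∣ x∈)

all-points : ∀ {n} (p : Subset n) → (∀ x → x ∈ₛ p) → n ≤ ∣ p ∣
all-points {n} p all = subst (_≤ ∣ p ∣) (∣⊤∣≡n n) (p⊆q⇒∣p∣≤∣q∣ {p = ⊤} (λ {x} _ → all x))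

∣p∪q∣≤∣p∣+∣q∣ : ∀ {n} (p q : Subset n) → ∣ p ∪ q ∣ ≤ ∣ p ∣ + ∣ q ∣
∣p∪q∣≤∣p∣+∣q∣ [] [] = z≤n
∣p∪q∣≤∣p∣+∣q∣ (true ∷ p) (y ∷ q) = s≤s (≤-trans (∣p∪q∣≤∣p∣+∣q∣ p q) (+-monoʳ-≤ ∣ p ∣ (∣p∣≤∣x∷p∣ y q)))
∣p∪q∣≤∣p∣+∣q∣ (false ∷ p) (true ∷ q) = ≤-trans (s≤s (∣p∪q∣≤∣p∣+∣q∣ p q)) (≤-reflexive (sym (+-suc ∣ p ∣ ∣ q ∣)))
∣p∪q∣≤∣p∣+∣q∣ (false ∷ p) (false ∷ q) = ∣p∪q∣≤∣p∣+∣q∣ p q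

all-points₂ : ∀ {n} (p q : Subset n) → (∀ x → x ∈ₛ p ⊎ x ∈ₛ q) → n ≤ ∣ p ∣ + ∣ q ∣
all-points₂ p q all = ≤-trans (all-points (p ∪ q) (λ x → x∈p∪q⁺ (all x))) (∣p∪q∣≤∣p∣+∣q∣ p q)

common-outside : ∀ {n} (p q : Subset n) → ∣ p ∣ + ∣ q ∣ < n → Nonempty (∁ p ∩ ∁ q)
common-outside p q small with nonempty? (∁ p ∩ ∁ q)
... | yes outside = outside
... | no ¬outside = contradiction (all-points₂ p q in-p-or-q) (<⇒≱ small)
  where
  in-p-or-q : ∀ x → x ∈ₛ p ⊎ x ∈ₛ q
  in-p-or-q x with x ∈? p | x ∈? q
  ... | yes x∈p | _ = inj₁ x∈p
  ... | no _ | yes x∈q = inj₂ x∈q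
  ... | no x∉p | no x∉q = ⊥-elim (¬outside (x , x∈p∩q⁺ (x∉p⇒x∈∁p x∉p , x∉p⇒x∈∁p x∉q)))

cover-or-miss : ∀ {n} (H : Hypergraph n) (C : Subset n) →
                IsCover H C ⊎ ∃ λ e → e ∈ H × ¬ Nonempty (e ∩ C)
cover-or-miss H C with All.all? (λ e → nonempty? (e ∩ C)) H
... | yes covered = inj₁ (All.lookup covered)
... | no ¬covered = inj₂ (find (¬All⇒Any¬ (λ e → nonempty? (e ∩ C)) H ¬covered))

meets⇒1≤∣C∣ : ∀ {n} (e C : Subset n) → Nonempty (e ∩ C) → 1 ≤ ∣ C ∣
meets⇒1≤∣C∣ e C (x , x∈) = one-point C (proj₂ (x∈p∩q⁻ e C x∈))

two-vertex-cover : ∀ {n} (H : Hypergraph n) {e} → e ∈ H →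
                   (∀ v → ∃ λ f → f ∈ H × v ∉ₛ f) → ∀ C → IsCover H C → 2 ≤ ∣ C ∣
two-vertex-cover H e∈ avoid C cover with cover e∈
... | v , v∈e∩C with avoid v
...   | f , f∈ , v∉f with cover f∈
...     | u , u∈f∩C = two-points C (proj₂ (x∈p∩q⁻ _ C v∈e∩C)) (proj₂ (x∈p∩q⁻ f C u∈f∩C))
                        (λ { refl → v∉f (proj₁ (x∈p∩q⁻ f C u∈f∩C)) })

Profile : ∀ {n} → Subset n → Subset n → ℕ → ℕ → Set
Profile c e x y = ∣ e ∩ c ∣ ≡ x × ∣ e ∩ ∁ c ∣ ≡ y

profile-++ : ∀ {m n} {c e : Subset m} {c' e' : Subset n} {x y x' y'} →
             Profile c e x y → Profile c' e' x' y' → Profile (c ++ c') (e ++ e') (x + x') (y + y')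
profile-++ {c = c} {e} {c'} {e'} (ex , ey) (ex' , ey') =
    trans (∣∩++∣ e c e' c') (cong₂ _+_ ex ex')
  , trans (cong (λ d → ∣ (e ++ e') ∩ d ∣) (∁-++ c c')) (trans (∣∩++∣ e (∁ c) e' (∁ c')) (cong₂ _+_ ey ey'))

profile-⊤ : ∀ {n} (e : Subset n) → Profile ⊤ e ∣ e ∣ 0
profile-⊤ {n} e =
    cong ∣_∣ (∩-identityʳ e)
  , trans (cong (λ d → ∣ e ∩ d ∣) (∁⊤≡⊥ n)) (trans (cong ∣_∣ (∩-zeroʳ e)) (∣⊥∣≡0 n))

profile-⊥ : ∀ {n} (e : Subset n) → Profile ⊥ e 0 ∣ e ∣
profile-⊥ {n} e =
    trans (cong ∣_∣ (∩-zeroʳ e)) (∣⊥∣≡0 n)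
  , trans (cong (λ d → ∣ e ∩ d ∣) (∁⊥≡⊤ n)) (cong ∣_∣ (∩-identityʳ e))

profile-of-⊥ : ∀ {n} (c : Subset n) → Profile c ⊥ 0 0
profile-of-⊥ {n} c = trans (cong ∣_∣ (∩-zeroˡ c)) (∣⊥∣≡0 n) , trans (cong ∣_∣ (∩-zeroˡ (∁ c))) (∣⊥∣≡0 n)

record Realisation (a b : ℕ) : Set where
  field
    n : ℕ
    edges : Hypergraph n
    colour : Subset n
    profile : ∀ {e} → e ∈ edges → Profile colour e a b
    intersecting : Intersecting edges
    cover-bound : ∀ C → IsCover edges C → a + b ≤ ∣ C ∣
    some-edge : Subset n
    some-edge∈ : some-edge ∈ edges

record Gadget (a b p q : ℕ) : Set where
  field
    m : ℕ
    colour : Subset m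
    guards tails : Hypergraph m
    guard-profile : ∀ {g} → g ∈ guards → Profile colour g p q
    tail-profile : ∀ {t} → t ∈ tails → Profile colour t (p + a) (q + b)
    guards-meet-tails : ∀ {g t} → g ∈ guards → t ∈ tails → Nonempty (g ∩ t)
    tails-intersecting : Intersecting tails
    guard-cover-bound : ∀ C → IsCover guards C → (p + a) + (q + b) ≤ ∣ C ∣
    tail-cover-bound : ∀ C → IsCover tails C → p + q ≤ ∣ C ∣
    some-guard : Subset m
    some-guard∈ : some-guard ∈ guards

swap : ∀ {a b} → Realisation b a → Realisation a b
swap {a} {b} R = record
  { n = n ; edges = edges ; colour = ∁ colour
  ; profile = λ {e} e∈ → proj₂ (profile e∈) , trans (cong (λ d → ∣ e ∩ d ∣) (∁-involutive colour)) (proj₁ (profile e∈))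
  ; intersecting = intersecting
  ; cover-bound = λ C cover → subst (_≤ ∣ C ∣) (+-comm b a) (cover-bound C cover)
  ; some-edge = some-edge ; some-edge∈ = some-edge∈
  }
  where open Realisation R

extended : ∀ {m n} → Hypergraph m → Hypergraph m → Hypergraph n → Hypergraph (m + n)
extended guards tails H = cartesianProductWith _++_ guards H ++ₗ map (_++ ⊥) tails

data ExtendedEdge {m n} (guards tails : Hypergraph m) (H : Hypergraph n) : Subset (m + n) → Set where
  joined : ∀ {g e} → g ∈ guards → e ∈ H → ExtendedEdge guards tails H (g ++ e)
  padded : ∀ {t} → t ∈ tails → ExtendedEdge guards tails H (t ++ ⊥)

module _ {m n} (guards tails : Hypergraph m) (H : Hypergraph n) where

  joined∈ : ∀ {g e} → g ∈ guards → e ∈ H → (g ++ e) ∈ extended guards tails H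
  joined∈ g∈ e∈ = ∈-++⁺ˡ (∈-cartesianProductWith⁺ _++_ g∈ e∈)

  padded∈ : ∀ {t} → t ∈ tails → (t ++ ⊥) ∈ extended guards tails H
  padded∈ t∈ = ∈-++⁺ʳ (cartesianProductWith _++_ guards H) (∈-map⁺ (_++ ⊥) t∈)

  classify : ∀ {x} → x ∈ extended guards tails H → ExtendedEdge guards tails H x
  classify x∈ with ∈-++⁻ (cartesianProductWith _++_ guards H) x∈
  ... | inj₁ x∈joined with ∈-cartesianProductWith⁻ _++_ guards H x∈joined
  ...   | _ , _ , g∈ , e∈ , refl = joined g∈ e∈
  classify x∈ | inj₂ x∈padded with ∈-map⁻ (_++ ⊥) x∈padded
  ...   | _ , t∈ , refl = padded t∈

extend : ∀ {a b p q} → Realisation a b → Gadget a b p q → Realisation (p + a) (q + b)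
extend {a} {b} {p} {q} R G = record
  { n = m + n
  ; edges = H'
  ; colour = G.colour ++ colour
  ; profile = λ x∈ → edge-profile (classify G.guards G.tails edges x∈)
  ; intersecting = λ x∈ y∈ → meet (classify G.guards G.tails edges x∈) (classify G.guards G.tails edges y∈)
  ; cover-bound = extended-cover-bound
  ; some-edge = G.some-guard ++ some-edge
  ; some-edge∈ = joined∈ G.guards G.tails edges G.some-guard∈ some-edge∈
  }
  where
  open Realisation R
  module G = Gadget G
  m : ℕ
  m = G.m

  H' : Hypergraph (m + n)
  H' = extended G.guards G.tails edges

  edge-profile : ∀ {x} → ExtendedEdge G.guards G.tails edges x → Profile (G.colour ++ colour) x (p + a) (q + b)
  edge-profile (joined {g} {e} g∈ e∈) = profile-++ {e = g} {e' = e} (G.guard-profile g∈) (profile e∈)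
  edge-profile (padded {t} t∈) = subst₂ (Profile (G.colour ++ colour) (t ++ ⊥)) (+-identityʳ (p + a)) (+-identityʳ (q + b))
    (profile-++ {e = t} {e' = ⊥} (G.tail-profile t∈) (profile-of-⊥ colour))

  meet : ∀ {x y} → ExtendedEdge G.guards G.tails edges x → ExtendedEdge G.guards G.tails edges y → Nonempty (x ∩ y)
  meet (joined {g} {e} _ e∈) (joined {g'} {e'} _ e∈') = meets-++⁺ g g' e e' (inj₂ (intersecting e∈ e∈'))
  meet (joined {g} {e} g∈ _) (padded {t} t∈) = meets-++⁺ g t e ⊥ (inj₁ (G.guards-meet-tails g∈ t∈))
  meet (padded {t} t∈) (joined {g} {e} g∈ _) = meets-++⁺ t g ⊥ e (inj₁ (meets-comm g t (G.guards-meet-tails g∈ t∈)))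
  meet (padded {t} t∈) (padded {t'} t∈') = meets-++⁺ t t' ⊥ ⊥ (inj₁ (G.tails-intersecting t∈ t∈'))

  -- Split a cover into its gadget part and its old part: either the old part covers
  -- the old edges (then the gadget part covers the tails), or it misses an edge e
  -- (then the gadget part covers the guards, through the edges g ++ e).
  extended-cover-bound : ∀ C → IsCover H' C → (p + a) + (q + b) ≤ ∣ C ∣
  extended-cover-bound C cover with splitAt m C
  ... | Cg , Ch , refl with cover-or-miss edges Ch
  ...   | inj₁ covers-old = begin
            (p + a) + (q + b)     ≡⟨ interchange p a q b ⟩
            (p + q) + (a + b)     ≤⟨ +-mono-≤ (G.tail-cover-bound Cg covers-tails) (cover-bound Ch covers-old) ⟩
            ∣ Cg ∣ + ∣ Ch ∣       ≡⟨ ∣++∣ Cg Ch ⟨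
            ∣ Cg ++ Ch ∣          ∎
    where
    open ≤-Reasoning
    covers-tails : IsCover G.tails Cg
    covers-tails {t} t∈ with meets-++⁻ t Cg ⊥ Ch (cover (padded∈ G.guards G.tails edges t∈))
    ... | inj₁ meets = meets
    ... | inj₂ meets = ⊥-elim (¬⊥-meets Ch meets)
  ...   | inj₂ (e , e∈ , misses) = begin
            (p + a) + (q + b)     ≤⟨ G.guard-cover-bound Cg covers-guards ⟩
            ∣ Cg ∣                ≤⟨ m≤m+n ∣ Cg ∣ ∣ Ch ∣ ⟩
            ∣ Cg ∣ + ∣ Ch ∣       ≡⟨ ∣++∣ Cg Ch ⟨
            ∣ Cg ++ Ch ∣          ∎
    where
    open ≤-Reasoning
    covers-guards : IsCover G.guards Cg
    covers-guards {g} g∈ with meets-++⁻ g Cg e Ch (cover (joined∈ G.guards G.tails edges g∈ e∈))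
    ... | inj₁ meets = meets
    ... | inj₂ meets = ⊥-elim (misses meets)

single-vertex : Realisation 0 1
single-vertex = record
  { n = 1 ; edges = ⊤ ∷ₗ []ₗ ; colour = ⊥
  ; profile = λ { (here refl) → profile-⊥ (⊤ {1}) }
  ; intersecting = λ { (here refl) (here refl) → zero , here }
  ; cover-bound = λ C cover → meets⇒1≤∣C∣ ⊤ C (cover (here refl))
  ; some-edge = ⊤ ; some-edge∈ = here refl
  }

singleton-gadget : ∀ b → Gadget 0 b 0 1
singleton-gadget b = record
  { m = suc b ; colour = ⊥
  ; guards = singletons ; tails = ⊤ ∷ₗ []ₗ
  ; guard-profile = singleton-profile
  ; tail-profile = λ { (here refl) → subst (Profile (⊥ {suc b}) ⊤ 0) (∣⊤∣≡n (suc b)) (profile-⊥ (⊤ {suc b})) }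
  ; guards-meet-tails = λ { g∈ (here refl) → singleton-meets-⊤ g∈ }
  ; tails-intersecting = λ { (here refl) (here refl) → zero , here }
  ; guard-cover-bound = λ C cover → all-points C (λ i → ⁅⁆-meets⁻ C (cover (singleton∈ i)))
  ; tail-cover-bound = λ C cover → meets⇒1≤∣C∣ ⊤ C (cover (here refl))
  ; some-guard = ⁅ zero ⁆ ; some-guard∈ = singleton∈ zero
  }
  where
  singletons : Hypergraph (suc b)
  singletons = map ⁅_⁆ (allFin (suc b))

  singleton∈ : ∀ i → ⁅ i ⁆ ∈ singletons
  singleton∈ i = ∈-map⁺ ⁅_⁆ {x = i} (∈-allFin i)

  singleton-profile : ∀ {g} → g ∈ singletons → Profile ⊥ g 0 1
  singleton-profile g∈ with ∈-map⁻ ⁅_⁆ {xs = allFin (suc b)} g∈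
  ... | i , _ , refl = subst (Profile ⊥ ⁅ i ⁆ 0) (∣⁅x⁆∣≡1 i) (profile-⊥ ⁅ i ⁆)

  singleton-meets-⊤ : ∀ {g} → g ∈ singletons → Nonempty (g ∩ ⊤)
  singleton-meets-⊤ g∈ with ∈-map⁻ ⁅_⁆ {xs = allFin (suc b)} g∈
  ... | i , _ , refl = ⁅⁆-meets⁺ ⊤ ∈⊤

realisation₀ : ∀ b → Realisation 0 (suc b)
realisation₀ zero = single-vertex
realisation₀ (suc b) = extend (realisation₀ b) (singleton-gadget (suc b))

record SpreadFamily (s k : ℕ) : Set where
  field
    members : List (Subset k)
    member-size : ∀ {I} → I ∈ members → ∣ I ∣ ≡ s
    inside : ∀ x → ∃ λ I → I ∈ members × x ∈ₛ I
    outside : ∀ x → ∃ λ I → I ∈ members × x ∉ₛ I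

-- Fin (1+a + 1+(e+a)) in blocks X, Z, W of sizes 1+a, 1+e, a; the members are X
-- and the sets {z} ∪ W for z ∈ Z.
spread-family : ∀ a e → SpreadFamily (suc a) (suc a + suc (e + a))
spread-family a e = record
  { members = X ∷ₗ map ZW (allFin (suc e))
  ; member-size = λ { (here refl) → ∣X∣ ; (there I∈) → ∣ZW∣ I∈ }
  ; inside = inside
  ; outside = outside
  }
  where
  X : Subset (suc a + (suc e + a))
  X = ⊤ {suc a} ++ ⊥ {suc e + a}

  ZW : Fin (suc e) → Subset (suc a + (suc e + a))
  ZW z = ⊥ {suc a} ++ (⁅ z ⁆ ++ ⊤ {a})

  ZW∈ : ∀ z → ZW z ∈ (X ∷ₗ map ZW (allFin (suc e)))
  ZW∈ z = there (∈-map⁺ ZW {x = z} (∈-allFin z))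

  ∣X∣ : ∣ X ∣ ≡ suc a
  ∣X∣ = trans (∣++∣ (⊤ {suc a}) (⊥ {suc e + a}))
              (trans (cong₂ _+_ (∣⊤∣≡n (suc a)) (∣⊥∣≡0 (suc e + a))) (+-identityʳ (suc a)))

  ∣ZW∣ : ∀ {I} → I ∈ map ZW (allFin (suc e)) → ∣ I ∣ ≡ suc a
  ∣ZW∣ I∈ with ∈-map⁻ ZW {xs = allFin (suc e)} I∈
  ... | z , _ , refl = trans (∣++∣ (⊥ {suc a}) (⁅ z ⁆ ++ ⊤ {a}))
                             (cong₂ _+_ (∣⊥∣≡0 (suc a)) (trans (∣++∣ ⁅ z ⁆ (⊤ {a})) (cong₂ _+_ (∣⁅x⁆∣≡1 z) (∣⊤∣≡n a))))

  inside : ∀ x → ∃ λ I → I ∈ (X ∷ₗ map ZW (allFin (suc e))) × x ∈ₛ I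
  inside x with block (suc a) (suc e + a) x
  ... | left i = X , here refl , ∈-↑ˡ⁺ (⊤ {suc a}) (⊥ {suc e + a}) ∈⊤
  ... | right y with block (suc e) a y
  ...   | left z = ZW z , ZW∈ z , ∈-↑ʳ⁺ (⊥ {suc a}) (⁅ z ⁆ ++ ⊤ {a}) (∈-↑ˡ⁺ ⁅ z ⁆ (⊤ {a}) (x∈⁅x⁆ z))
  ...   | right w = ZW zero , ZW∈ zero , ∈-↑ʳ⁺ (⊥ {suc a}) (⁅ zero ⁆ ++ ⊤ {a}) (∈-↑ʳ⁺ (⁅_⁆ {suc e} zero) (⊤ {a}) ∈⊤)

  outside : ∀ x → ∃ λ I → I ∈ (X ∷ₗ map ZW (allFin (suc e))) × x ∉ₛ I
  outside x with block (suc a) (suc e + a) x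
  ... | left i = ZW zero , ZW∈ zero , λ x∈ → ∉⊥ (∈-↑ˡ⁻ (⊥ {suc a}) (⁅ zero ⁆ ++ ⊤ {a}) x∈)
  ... | right y = X , here refl , λ x∈ → ∉⊥ (∈-↑ʳ⁻ (⊤ {suc a}) (⊥ {suc e + a}) x∈)

-- Two tails meet in the second copy because |I| + |J| = 2(1+a) < k.
doubling-gadget : ∀ {a b} → a < b → SpreadFamily (suc a) (suc a + suc b) → Gadget a b 1 1
doubling-gadget {a} {b} a<b F = record
  { m = k + k ; colour = ⊤ {k} ++ ⊥ {k}
  ; guards = pairs ; tails = twins
  ; guard-profile = pair-profile
  ; tail-profile = twin-profile
  ; guards-meet-tails = pair-meets-twin
  ; tails-intersecting = twins-intersecting
  ; guard-cover-bound = pair-cover-bound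
  ; tail-cover-bound = λ C → two-vertex-cover twins (twin∈ (proj₁ (proj₂ (inside zero)))) avoid C
  ; some-guard = pair zero ; some-guard∈ = pair∈ zero
  }
  where
  open SpreadFamily F
  k = suc a + suc b

  pair : Fin k → Subset (k + k)
  pair i = ⁅ i ⁆ ++ ⁅ i ⁆

  twin : Subset k → Subset (k + k)
  twin I = I ++ ∁ I

  pairs twins : Hypergraph (k + k)
  pairs = map pair (allFin k)
  twins = map twin members

  pair∈ : ∀ i → pair i ∈ pairs
  pair∈ i = ∈-map⁺ pair {x = i} (∈-allFin i)

  twin∈ : ∀ {I} → I ∈ members → twin I ∈ twins
  twin∈ = ∈-map⁺ twin

  copies-profile : ∀ (x y : Subset k) → Profile (⊤ {k} ++ ⊥ {k}) (x ++ y) ∣ x ∣ ∣ y ∣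
  copies-profile x y =
    subst₂ (Profile _ (x ++ y)) (+-identityʳ ∣ x ∣) refl (profile-++ {e = x} {e' = y} (profile-⊤ x) (profile-⊥ y))

  pair-profile : ∀ {g} → g ∈ pairs → Profile (⊤ {k} ++ ⊥ {k}) g 1 1
  pair-profile g∈ with ∈-map⁻ pair {xs = allFin k} g∈
  ... | i , _ , refl = subst₂ (Profile _ (pair i)) (∣⁅x⁆∣≡1 i) (∣⁅x⁆∣≡1 i) (copies-profile ⁅ i ⁆ ⁅ i ⁆)

  ∣∁I∣ : ∀ {I} → I ∈ members → ∣ ∁ I ∣ ≡ suc b
  ∣∁I∣ {I} I∈ = trans (∣∁p∣≡n∸∣p∣ I) (trans (cong (k ∸_) (member-size I∈)) (m+n∸m≡n (suc a) (suc b)))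

  twin-profile : ∀ {t} → t ∈ twins → Profile (⊤ {k} ++ ⊥ {k}) t (suc a) (suc b)
  twin-profile t∈ with ∈-map⁻ twin t∈
  ... | I , I∈ , refl = subst₂ (Profile _ (twin I)) (member-size I∈) (∣∁I∣ I∈) (copies-profile I (∁ I))

  pair-meets-twin : ∀ {g t} → g ∈ pairs → t ∈ twins → Nonempty (g ∩ t)
  pair-meets-twin g∈ t∈ with ∈-map⁻ pair {xs = allFin k} g∈ | ∈-map⁻ twin t∈
  ... | i , _ , refl | I , _ , refl with i ∈? I
  ...   | yes i∈I = meets-++⁺ ⁅ i ⁆ I ⁅ i ⁆ (∁ I) (inj₁ (⁅⁆-meets⁺ I i∈I))
  ...   | no i∉I = meets-++⁺ ⁅ i ⁆ I ⁅ i ⁆ (∁ I) (inj₂ (⁅⁆-meets⁺ (∁ I) (x∉p⇒x∈∁p i∉I)))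

  twins-intersecting : Intersecting twins
  twins-intersecting t∈ t∈' with ∈-map⁻ twin t∈ | ∈-map⁻ twin t∈'
  ... | I , I∈ , refl | J , J∈ , refl = meets-++⁺ I J (∁ I) (∁ J) (inj₂ (common-outside I J small))
    where
    small : ∣ I ∣ + ∣ J ∣ < k
    small rewrite member-size I∈ | member-size J∈ = +-monoʳ-< (suc a) (s≤s a<b)

  pair-cover-bound : ∀ C → IsCover pairs C → suc a + suc b ≤ ∣ C ∣
  pair-cover-bound C cover with splitAt k C
  ... | Cx , Cy , refl = subst (k ≤_) (sym (∣++∣ Cx Cy)) (all-points₂ Cx Cy in-a-copy)
    where
    in-a-copy : ∀ i → i ∈ₛ Cx ⊎ i ∈ₛ Cy
    in-a-copy i with meets-++⁻ ⁅ i ⁆ Cx ⁅ i ⁆ Cy (cover (pair∈ i))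
    ... | inj₁ meets = inj₁ (⁅⁆-meets⁻ Cx meets)
    ... | inj₂ meets = inj₂ (⁅⁆-meets⁻ Cy meets)

  avoid : ∀ v → ∃ λ t → t ∈ twins × v ∉ₛ t
  avoid v with block k k v
  ... | left x = let I , I∈ , x∉I = outside x in twin I , twin∈ I∈ , λ v∈ → x∉I (∈-↑ˡ⁻ I (∁ I) v∈)
  ... | right y = let I , I∈ , y∈I = inside y in twin I , twin∈ I∈ , λ v∈ → x∈p⇒x∉∁p y∈I (∈-↑ʳ⁻ I (∁ I) v∈)

realisation : ∀ a b → a < b → Realisation a b
realisation zero (suc b) _ = realisation₀ b
realisation (suc a) (suc b) (s≤s a<b) = extend (realisation a b a<b) (doubling-gadget a<b spread)
  where
  spread : SpreadFamily (suc a) (suc a + suc b)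
  spread = subst (λ c → SpreadFamily (suc a) (suc a + suc c)) (m∸n+n≡m (<⇒≤ a<b)) (spread-family a (b ∸ a))

distinct-realisation : ∀ {a b} → a ≢ b → Realisation a b
distinct-realisation {a} {b} a≢b with <-cmp a b
... | tri< a<b _ _ = realisation a b a<b
... | tri≈ _ a≡b _ = contradiction a≡b a≢b
... | tri> _ _ b<a = swap (realisation b a b<a)

part-of-colour : Bool → Fin 2
part-of-colour true = zero
part-of-colour false = suc zero

colour-partition : ∀ {n} → Subset n → Fin n → Fin 2
colour-partition c v = part-of-colour (lookup c v)

Part-second : ∀ {n} (part : Fin n → Fin 2) → Part part (suc zero) ≡ ∁ (Part part zero)
Part-second part = trans (tabulate-cong (λ v → second (part v))) (tabulate-∘ not (λ v → does (part v ≟ zero)))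
  where
  second : ∀ (i : Fin 2) → does (i ≟ suc zero) ≡ not (does (i ≟ zero))
  second zero = refl
  second (suc zero) = refl

Part-colour : ∀ {n} (c : Subset n) → Part (colour-partition c) zero ≡ c
Part-colour c = trans (tabulate-cong (λ v → first (lookup c v))) (tabulate∘lookup c)
  where
  first : ∀ x → does (part-of-colour x ≟ zero) ≡ x
  first true = refl
  first false = refl

edge-size : ∀ {n a b} {H : Hypergraph n} → Partitioned (a ∷ b ∷ []) H → ∀ {e} → e ∈ H → ∣ e ∣ ≡ a + b
edge-size (part , sizes) {e} e∈ =
  trans (size-split e (Part part zero))
        (cong₂ _+_ (sizes e∈ zero) (trans (cong (λ d → ∣ e ∩ d ∣) (sym (Part-second part))) (sizes e∈ (suc zero))))

-- Upper bound: an edge is a cover (and ∅ covers the empty hypergraph).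
cover-number-≤ : ∀ a b (n : ℕ) (H : Hypergraph n) (k : ℕ) →
                 Intersecting H → Partitioned (a ∷ b ∷ []) H → IsCoverNumber H k → k ≤ a + b
cover-number-≤ a b n []ₗ k _ _ (_ , minimal) = ≤-trans (subst (k ≤_) (∣⊥∣≡0 n) (minimal ⊥ (λ ()))) z≤n
cover-number-≤ a b n (e ∷ₗ H) k intersecting partitioned (_ , minimal) =
  subst (k ≤_) (edge-size partitioned (here refl)) (minimal e (λ f∈ → intersecting f∈ (here refl)))

realised : ∀ {a b} → Realisation a b →
           Σ ℕ λ n → Σ (Hypergraph n) λ H → Intersecting H × Partitioned (a ∷ b ∷ []) H × IsCoverNumber H (a + b)
realised {a} {b} R =
  n , edges , intersecting , partitioned ,
  ((some-edge , (λ e∈ → intersecting e∈ some-edge∈) , edge-size partitioned some-edge∈) , cover-bound)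
  where
  open Realisation R
  sizes : ∀ {e} → e ∈ edges → ∀ i → ∣ e ∩ Part (colour-partition colour) i ∣ ≡ lookup (a ∷ b ∷ []) i
  sizes {e} e∈ zero = trans (cong (λ d → ∣ e ∩ d ∣) (Part-colour colour)) (proj₁ (profile e∈))
  sizes {e} e∈ (suc zero) =
    trans (cong (λ d → ∣ e ∩ d ∣) (trans (Part-second (colour-partition colour)) (cong ∁ (Part-colour colour)))) (proj₂ (profile e∈))
  partitioned : Partitioned (a ∷ b ∷ []) edges
  partitioned = colour-partition colour , sizes

theorem1p2 : ∀ (a b : ℕ) → 1 ≤ a → 1 ≤ b → a ≢ b → IsT (a ∷ b ∷ []) (a + b)
theorem1p2 a b _ _ a≢b = cover-number-≤ a b , realised (distinct-realisation a≢b)
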